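{- The following two rules are safe (the input instance is a yes-instance iff the output instance is) both for \textsc{Trivially Perfect Deletion} and for \textsc{Trivially Perfect Completion}. Rule 3: if $Q\subseteq V(G)$ is a true twin class with $|Q|>2k+5$ and $v\in Q$ is arbitrary, replace $(G,k)$ by $(G-v,k)$. Rule 4: if $M\subseteq V(G)$ is a module such that $G[M]$ is trivially perfect and contains an independent set of size at least $2k+5$, take any independent set $I\subseteq M$ of size $2k+4$ and replace $(G,k)$ by $(G-(M\setminus I),k)$.
   Context: Graphs are finite, simple, undirected; a graph is trivially perfect if it has no induced $C_4$ or $P_4$. \textsc{Trivially Perfect Deletion}: given $(G,k)$, decide whether deleting some set of at most $k$ edges of $G$ yields a trivially perfect graph. \textsc{Trivially Perfect Completion}: given $(G,k)$, decide whether adding some set of at most $k$ non-edges of $G$ yields a trivially perfect graph. A true twin class is an inclusion-wise maximal set of vertices with pairwise equal closed neighborhoods. A module is a set $M\subseteq V(G)$ with $N(u)\setminus M=N(v)\setminus M$ for all $u,v\in M$. -}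

module Defs where

open import Data.Nat using (ℕ; zero; suc; _+_; _≤_; _<_; _<ᵇ_)
open import Data.Fin using (Fin; toℕ; punchIn)
open import Data.Fin.Subset using (Subset; _∈_; _∉_; _⊆_; ∣_∣)
open import Data.Bool using (Bool; true; false; if_then_else_; _∧_; _xor_)
open import Data.List using (List; map; allFin; concatMap)
open import Data.Nat.ListAction using (sum)
open import Data.Product using (Σ; ∃; ∃-syntax; _×_; _,_)
open import Data.Sum using (_⊎_)
open import Relation.Nullary using (¬_)
open import Relation.Binary.PropositionalEquality using (_≡_; _≢_)
open import Function.Bundles using (_⇔_)
open import Function.Definitions using (Injective)

record Graph (n : ℕ) : Set where
  field
    adj    : Fin n → Fin n → Bool
    sym    : ∀ u v → adj u v ≡ adj v u
    irrefl : ∀ u → adj u u ≡ false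
open Graph public

E : ∀ {n} → Graph n → Fin n → Fin n → Set
E G u v = adj G u v ≡ true

Distinct4 : ∀ {n} → Fin n → Fin n → Fin n → Fin n → Set
Distinct4 a b c d = a ≢ b × a ≢ c × a ≢ d × b ≢ c × b ≢ d × c ≢ d

InducedP4 : ∀ {n} → Graph n → Fin n → Fin n → Fin n → Fin n → Set
InducedP4 G a b c d =
  Distinct4 a b c d × E G a b × E G b c × E G c d
  × ¬ E G a c × ¬ E G b d × ¬ E G a d

InducedC4 : ∀ {n} → Graph n → Fin n → Fin n → Fin n → Fin n → Set
InducedC4 G a b c d =
  Distinct4 a b c d × E G a b × E G b c × E G c d × E G d a
  × ¬ E G a c × ¬ E G b d

TriviallyPerfectOn : ∀ {n} → Graph n → Subset n → Set
TriviallyPerfectOn G S = ∀ a b c d → a ∈ S → b ∈ S → c ∈ S → d ∈ S →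
  ¬ InducedP4 G a b c d × ¬ InducedC4 G a b c d

TriviallyPerfect : ∀ {n} → Graph n → Set
TriviallyPerfect G = ∀ a b c d → ¬ InducedP4 G a b c d × ¬ InducedC4 G a b c d

edgeDiff : ∀ {n} → Graph n → Graph n → ℕ
edgeDiff {n} G H = sum (concatMap (λ u → map (λ v →
    if (toℕ u <ᵇ toℕ v) ∧ (adj G u v xor adj H u v) then 1 else 0)
    (allFin n)) (allFin n))

_⊑_ : ∀ {n} → Graph n → Graph n → Set
H ⊑ G = ∀ u v → E H u v → E G u v

TPDeletion : ∀ {n} → Graph n → ℕ → Set
TPDeletion {n} G k = ∃[ H ] (H ⊑ G × edgeDiff G H ≤ k × TriviallyPerfect H)

TPCompletion : ∀ {n} → Graph n → ℕ → Set
TPCompletion {n} G k = ∃[ H ] (G ⊑ H × edgeDiff G H ≤ k × TriviallyPerfect H)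

-- Induced subgraph along a vertex map f : Fin m → Fin n
-- (used with injective f, so this is G[image f] up to relabelling)
induce : ∀ {m n} → Graph n → (Fin m → Fin n) → Graph m
induce G f = record
  { adj = λ i j → adj G (f i) (f j)
  ; sym = λ i j → sym G (f i) (f j)
  ; irrefl = λ i → irrefl G (f i) }

delVertex : ∀ {n} → Graph (suc n) → Fin (suc n) → Graph n
delVertex G v = induce G (punchIn v)

-- closed neighbourhoods N[u] and N[v] are equal
TrueTwins : ∀ {n} → Graph n → Fin n → Fin n → Set
TrueTwins G u v = ∀ w → ((w ≡ u ⊎ E G u w) ⇔ (w ≡ v ⊎ E G v w))

PairwiseTrueTwins : ∀ {n} → Graph n → Subset n → Set
PairwiseTrueTwins G Q = ∀ u v → u ∈ Q → v ∈ Q → TrueTwins G u v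

IsTrueTwinClass : ∀ {n} → Graph n → Subset n → Set
IsTrueTwinClass G Q = PairwiseTrueTwins G Q ×
  (∀ Q′ → Q ⊆ Q′ → PairwiseTrueTwins G Q′ → Q′ ⊆ Q)

IsModule : ∀ {n} → Graph n → Subset n → Set
IsModule G M = ∀ u v w → u ∈ M → v ∈ M → w ∉ M → (E G u w ⇔ E G v w)

IsIndependent : ∀ {n} → Graph n → Subset n → Set
IsIndependent G I = ∀ u v → u ∈ I → v ∈ I → ¬ E G u v

-- f : Fin m → Fin n is an injective enumeration of exactly the vertices
-- satisfying P (so induce G f is a copy of G[{x | P x}])
Enumerates : ∀ {m n} → (Fin m → Fin n) → (Fin n → Set) → Set
Enumerates f P = Injective _≡_ _≡_ f × (∀ x → P x ⇔ (∃[ i ] f i ≡ x))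

-- Both rules pass to an induced subgraph G[f].  Restricting a solution for G to the image of f
-- costs no more edits, and induced subgraphs of trivially perfect graphs are trivially perfect.
-- Conversely, the at most k edits of a solution H′ for G[f] touch at most 2k vertices, so the
-- twin class keeps an untouched vertex w ≠ v (Rule 3) and I keeps two untouched vertices w₁, w₂,
-- nonadjacent since I is independent (Rule 4).  For Rule 3, v is put back into H′ as a true twin
-- of w; for Rule 4, G[M] is put back and every vertex of M is attached to the rest of H′ as w₁ is.
-- This adds no edits, and no induced P4 or C4: these have no adjacent true twins; one inside M is
-- excluded since G[M] is trivially perfect; and one meeting M properly meets it in a proper module
-- of P4 or C4, hence in an independent set, which can be moved onto w₁ and w₂.  The argument only
-- needs 2k + 2 vertices in Q resp. I.

module Submission where

open import Defs hiding (sym)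
open import Algebra.Properties.CommutativeMonoid.Sum as Sum using ()
open import Data.Bool using (Bool; true; false; if_then_else_; _∧_; _∨_; _xor_; not)
open import Data.Bool.Properties using (xor-same; ¬-not; ∧-comm; ∧-zeroʳ) renaming (_≟_ to _≟ᵇ_)
open import Data.Empty using (⊥-elim)
open import Data.Fin using (Fin; zero; suc; toℕ; punchIn; punchOut)
open import Data.Fin.Patterns using (0F; 1F; 2F; 3F)
open import Data.Fin.Properties
  using ( _≟_; all?; any?; ¬∀⟶∃¬; 0≢1+n; suc-injective; toℕ-injective
        ; punchIn-injective; punchInᵢ≢i; punchIn-punchOut)
open import Data.Fin.Subset using (Subset; _∈_; _∉_; _⊆_; ⊤; ∣_∣)
open import Data.Fin.Subset.Properties using (_∈?_; anySubset?; ∈⊤)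
open import Data.List as List using (List; map; concatMap)
open import Data.Nat using (ℕ; zero; suc; _+_; _*_; _<_; _≤_; _<ᵇ_; _≡ᵇ_; z≤n; s≤s; z<s)
open import Data.Nat.ListAction using () renaming (sum to sumˡ)
open import Data.Nat.ListAction.Properties using (sum-++)
open import Data.Nat.Properties
  using ( +-0-commutativeMonoid; +-comm; +-identityʳ; +-mono-≤; +-monoˡ-≤; +-monoʳ-≤; *-monoʳ-≤
        ; +-cancelˡ-≤; +-cancelˡ-<; *-cancelˡ-≤; m≤m+n; n≤0⇒n≡0; ≮⇒≥; <ᵇ-reflects-<
        ; ≤-refl; ≤-reflexive; ≤-trans; ≤-antisym; ≤-<-trans; <-trans; <-asym; <-irrefl; module ≤-Reasoning)
open import Data.Product using (∃-syntax; _×_; _,_; proj₁; proj₂)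
open import Data.Sum using (_⊎_; inj₁; inj₂; [_,_]′)
open import Data.Vec as Vec using (tabulate; lookup)
open import Data.Vec.Functional using ([]; _∷_)
open import Data.Vec.Properties using (lookup∘tabulate; []=⇒lookup; lookup⇒[]=)
open import Function using (_∘_; id; case_of_)
open import Function.Bundles using (_⇔_; mk⇔; Equivalence)
open import Function.Definitions using (Injective)
open import Level using (0ℓ)
open import Relation.Binary.PropositionalEquality
open import Relation.Nullary using (¬_; Dec; does; yes; no; ¬?; _→-dec_; _×-dec_; map′)
open import Relation.Nullary.Decidable using (from-yes; decidable-stable; dec-true; dec-false)
open import Relation.Nullary.Reflects using (ofʸ; ofⁿ)
open import Relation.Unary using (Pred; Decidable)

-- Finite sums

open Sum +-0-commutativeMonoid using (sum; sum-cong-≗; ∑-distrib-+; ∑-comm; sum-remove)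

sum-mono-≤ : ∀ {n} {g h : Fin n → ℕ} → (∀ i → g i ≤ h i) → sum g ≤ sum h
sum-mono-≤ {zero}  g≤h = z≤n
sum-mono-≤ {suc n} g≤h = +-mono-≤ (g≤h zero) (sum-mono-≤ (g≤h ∘ suc))

lookup≤sum : ∀ {n} (g : Fin n → ℕ) i → g i ≤ sum g
lookup≤sum {suc n} g i = subst (g i ≤_) (sym (sum-remove g)) (m≤m+n (g i) _)

0<sum⇒∃0< : ∀ {n} (g : Fin n → ℕ) → 0 < sum g → ∃[ i ] 0 < g i
0<sum⇒∃0< {suc n} g pos with g zero in eq
... | suc _ = zero , subst (0 <_) (sym eq) z<s
... | zero with 0<sum⇒∃0< (g ∘ suc) pos
...   | i , gᵢ>0 = suc i , gᵢ>0

module _ {m n} {f : Fin (suc m) → Fin (suc n)} (f-inj : Injective _≡_ _≡_ f) where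

  private
    f₀ = f zero

    f₀≢ : ∀ i → f₀ ≢ f (suc i)
    f₀≢ i = 0≢1+n ∘ f-inj

  tailPunchOut : Fin m → Fin n
  tailPunchOut i = punchOut (f₀≢ i)

  punchIn-tailPunchOut : ∀ i → punchIn f₀ (tailPunchOut i) ≡ f (suc i)
  punchIn-tailPunchOut i = punchIn-punchOut (f₀≢ i)

  tailPunchOut-injective : Injective _≡_ _≡_ tailPunchOut
  tailPunchOut-injective {i} {j} eq = suc-injective (f-inj (begin
    f (suc i)                    ≡⟨ punchIn-tailPunchOut i ⟨
    punchIn f₀ (tailPunchOut i)  ≡⟨ cong (punchIn f₀) eq ⟩
    punchIn f₀ (tailPunchOut j)  ≡⟨ punchIn-tailPunchOut j ⟩
    f (suc j)                    ∎))
    where open ≡-Reasoning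

sum-∘-injective-≤ : ∀ {m n} (g : Fin n → ℕ) {f : Fin m → Fin n} →
  Injective _≡_ _≡_ f → sum (g ∘ f) ≤ sum g
sum-∘-injective-≤ {zero}          g f-inj = z≤n
sum-∘-injective-≤ {suc m} {zero}  g {f} f-inj with () ← f zero
sum-∘-injective-≤ {suc m} {suc n} g {f} f-inj = begin
  g a + sum (g ∘ f ∘ suc)            ≡⟨ cong (g a +_) (sum-cong-≗ (cong g ∘ punchIn-tailPunchOut f-inj)) ⟨
  g a + sum (g ∘ punchIn a ∘ h)      ≤⟨ +-monoʳ-≤ (g a) (sum-∘-injective-≤ (g ∘ punchIn a) (tailPunchOut-injective f-inj)) ⟩
  g a + sum (g ∘ punchIn a)          ≡⟨ sum-remove g ⟨
  sum g                              ∎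
  where
  open ≤-Reasoning
  a = f zero
  h = tailPunchOut f-inj

sum-≤-∘-injective : ∀ {m n} (g : Fin n → ℕ) {f : Fin m → Fin n} → Injective _≡_ _≡_ f →
  (∀ u → 0 < g u → ∃[ i ] f i ≡ u) → sum g ≤ sum (g ∘ f)
sum-≤-∘-injective {zero}          g f-inj onto =
  ≮⇒≥ λ pos → case onto _ (proj₂ (0<sum⇒∃0< g pos)) of λ ()
sum-≤-∘-injective {suc m} {zero}  g {f} f-inj onto with () ← f zero
sum-≤-∘-injective {suc m} {suc n} g {f} f-inj onto = begin
  sum g                              ≡⟨ sum-remove g ⟩
  g a + sum (g ∘ punchIn a)          ≤⟨ +-monoʳ-≤ (g a) (sum-≤-∘-injective (g ∘ punchIn a) (tailPunchOut-injective f-inj) onto′) ⟩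
  g a + sum (g ∘ punchIn a ∘ h)      ≡⟨ cong (g a +_) (sum-cong-≗ (cong g ∘ punchIn-tailPunchOut f-inj)) ⟩
  g a + sum (g ∘ f ∘ suc)            ∎
  where
  open ≤-Reasoning
  a = f zero
  h = tailPunchOut f-inj
  onto′ : ∀ u → 0 < g (punchIn a u) → ∃[ i ] h i ≡ u
  onto′ u pos with onto _ pos
  ... | zero  , a≡ = ⊥-elim (punchInᵢ≢i a u (sym a≡))
  ... | suc i , f[1+i]≡ = i , punchIn-injective a _ _ (trans (punchIn-tailPunchOut f-inj i) f[1+i]≡)

sum₂ : ∀ {n} → (Fin n → Fin n → ℕ) → ℕ
sum₂ g = sum (λ u → sum (g u))

sum₂-∘-injective-≤ : ∀ {m n} (g : Fin n → Fin n → ℕ) {f : Fin m → Fin n} →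
  Injective _≡_ _≡_ f → sum₂ (λ i j → g (f i) (f j)) ≤ sum₂ g
sum₂-∘-injective-≤ g {f} f-inj = ≤-trans
  (sum-mono-≤ (λ i → sum-∘-injective-≤ (g (f i)) f-inj))
  (sum-∘-injective-≤ (λ u → sum (g u)) f-inj)

sum₂-≤-∘-injective : ∀ {m n} (g : Fin n → Fin n → ℕ) {f : Fin m → Fin n} → Injective _≡_ _≡_ f →
  (∀ u v → 0 < g u v → (∃[ i ] f i ≡ u) × (∃[ j ] f j ≡ v)) →
  sum₂ g ≤ sum₂ (λ i j → g (f i) (f j))
sum₂-≤-∘-injective g {f} f-inj onto = ≤-trans
  (sum-≤-∘-injective (λ u → sum (g u)) f-inj
    (λ u pos → let v , gᵤᵥ>0 = 0<sum⇒∃0< (g u) pos in proj₁ (onto u v gᵤᵥ>0)))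
  (sum-mono-≤ (λ i → sum-≤-∘-injective (g (f i)) f-inj (λ v pos → proj₂ (onto (f i) v pos))))

indicator : Bool → ℕ
indicator b = if b then 1 else 0

size : ∀ {n} → (Fin n → Bool) → ℕ
size s = sum (indicator ∘ s)

indicator>0 : ∀ {b} → 0 < indicator b → b ≡ true
indicator>0 {true} _ = refl

indicator≤1 : ∀ b → indicator b ≤ 1
indicator≤1 true  = ≤-refl
indicator≤1 false = z≤n

size>0⇒∃ : ∀ {n} (s : Fin n → Bool) → 0 < size s → ∃[ u ] s u ≡ true
size>0⇒∃ s pos = let u , sᵤ = 0<sum⇒∃0< (indicator ∘ s) pos in u , indicator>0 sᵤ

size>1⇒∃₂ : ∀ {n} (s : Fin n → Bool) → 1 < size s → ∃[ u ] ∃[ w ] (u ≢ w × s u ≡ true × s w ≡ true)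
size>1⇒∃₂ {suc n} s big with size>0⇒∃ s (<-trans z<s big)
... | u , sᵤ with size>0⇒∃ (s ∘ punchIn u) (+-cancelˡ-< 1 0 _ (begin-strict
  1                                     <⟨ big ⟩
  size s                                ≡⟨ sum-remove (indicator ∘ s) ⟩
  indicator (s u) + size (s ∘ punchIn u) ≤⟨ +-monoˡ-≤ _ (indicator≤1 (s u)) ⟩
  1 + size (s ∘ punchIn u)              ∎))
  where open ≤-Reasoning
... | w , s-w = u , punchIn u w , (punchInᵢ≢i u w ∘ sym) , sᵤ , s-w

∣-∣≡size : ∀ {n} (S : Subset n) → ∣ S ∣ ≡ size (lookup S)
∣-∣≡size Vec.[]            = refl
∣-∣≡size (true  Vec.∷ S) = cong suc (∣-∣≡size S)
∣-∣≡size (false Vec.∷ S) = ∣-∣≡size S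

-- Edit degrees and untouched vertices

sumˡ-concatMap : ∀ {A : Set} (F : A → List ℕ) xs → sumˡ (concatMap F xs) ≡ sumˡ (map (sumˡ ∘ F) xs)
sumˡ-concatMap F List.[]       = refl
sumˡ-concatMap F (x List.∷ xs) = trans (sum-++ (F x) (concatMap F xs)) (cong (sumˡ (F x) +_) (sumˡ-concatMap F xs))

sumˡ-map-tabulate : ∀ {A : Set} {n} (g : A → ℕ) (h : Fin n → A) → sumˡ (map g (List.tabulate h)) ≡ sum (g ∘ h)
sumˡ-map-tabulate {n = zero}  g h = refl
sumˡ-map-tabulate {n = suc n} g h = cong (g (h zero) +_) (sumˡ-map-tabulate g (h ∘ suc))

module _ {n} (G H : Graph n) where

  disagreement : Fin n → Fin n → ℕ
  disagreement u v = indicator (adj G u v xor adj H u v)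

  editDegree : Fin n → ℕ
  editDegree u = sum (disagreement u)

  private
    upper : Fin n → Fin n → ℕ
    upper u v = indicator ((toℕ u <ᵇ toℕ v) ∧ (adj G u v xor adj H u v))

    edgeDiff≡sum₂-upper : edgeDiff G H ≡ sum₂ upper
    edgeDiff≡sum₂-upper = begin
      sumˡ (concatMap row (List.tabulate id))         ≡⟨ sumˡ-concatMap row (List.tabulate id) ⟩
      sumˡ (map (sumˡ ∘ row) (List.tabulate id))      ≡⟨ sumˡ-map-tabulate (sumˡ ∘ row) id ⟩
      sum (sumˡ ∘ row)                                ≡⟨ sum-cong-≗ (λ u → sumˡ-map-tabulate (upper u) id) ⟩
      sum₂ upper                                      ∎
      where
      open ≡-Reasoning
      row : Fin n → List ℕ
      row u = map (upper u) (List.tabulate id)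

    disagreement-sym : ∀ u v → disagreement u v ≡ disagreement v u
    disagreement-sym u v = cong indicator (cong₂ _xor_ (Graph.sym G u v) (Graph.sym H u v))

    disagreement-diag : ∀ u → disagreement u u ≡ 0
    disagreement-diag u rewrite irrefl G u | irrefl H u = refl

    disagreement-split : ∀ u v → disagreement u v ≡ upper u v + upper v u
    disagreement-split u v
      with toℕ u <ᵇ toℕ v | <ᵇ-reflects-< (toℕ u) (toℕ v)
         | toℕ v <ᵇ toℕ u | <ᵇ-reflects-< (toℕ v) (toℕ u)
    ... | true  | ofʸ u<v  | true  | ofʸ v<u  = ⊥-elim (<-asym u<v v<u)
    ... | true  | _        | false | _        = sym (+-identityʳ _)
    ... | false | _        | true  | _        = disagreement-sym u v
    ... | false | ofⁿ u≮v  | false | ofⁿ v≮u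
      rewrite toℕ-injective (≤-antisym (≮⇒≥ v≮u) (≮⇒≥ u≮v)) = disagreement-diag v

  sum-editDegree : sum editDegree ≡ 2 * edgeDiff G H
  sum-editDegree = begin
    sum₂ disagreement                                            ≡⟨ sum-cong-≗ (λ u → sum-cong-≗ (disagreement-split u)) ⟩
    sum (λ u → sum (λ v → upper u v + upper v u))                ≡⟨ sum-cong-≗ (λ u → ∑-distrib-+ (upper u) (λ v → upper v u)) ⟩
    sum (λ u → sum (upper u) + sum (λ v → upper v u))            ≡⟨ ∑-distrib-+ (λ u → sum (upper u)) _ ⟩
    sum₂ upper + sum (λ u → sum (λ v → upper v u))               ≡⟨ cong (sum₂ upper +_) (∑-comm (λ u v → upper v u)) ⟩
    sum₂ upper + sum₂ upper                                      ≡⟨ cong₂ _+_ edgeDiff≡sum₂-upper (trans (+-identityʳ _) edgeDiff≡sum₂-upper) ⟨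
    2 * edgeDiff G H                                             ∎
    where open ≡-Reasoning

Untouched : ∀ {n} → Graph n → Graph n → Fin n → Set
Untouched G H u = ∀ v → adj H u v ≡ adj G u v

module _ {n} (G H : Graph n) where

  editDegree≡0⇒untouched : ∀ {u} → editDegree G H u ≡ 0 → Untouched G H u
  editDegree≡0⇒untouched {u} deg≡0 v
    with adj G u v | adj H u v | n≤0⇒n≡0 (subst (_ ≤_) deg≡0 (lookup≤sum (disagreement G H u) v))
  ... | true  | true  | _ = refl
  ... | false | false | _ = refl

  private
    UntouchedIn : (Fin n → Bool) → Fin n → Bool
    UntouchedIn s u = s u ∧ (editDegree G H u ≡ᵇ 0)

    untouchedIn⇒ : ∀ s {u} → UntouchedIn s u ≡ true → s u ≡ true × Untouched G H u
    untouchedIn⇒ s {u} eq with s u | editDegree G H u in deg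
    ... | true | zero = refl , editDegree≡0⇒untouched deg

    indicator≤untouched+degree : ∀ s u → indicator (s u) ≤ indicator (UntouchedIn s u) + editDegree G H u
    indicator≤untouched+degree s u with s u | editDegree G H u
    ... | false | _     = z≤n
    ... | true  | zero  = ≤-refl
    ... | true  | suc _ = s≤s z≤n

    -- An edit set of size e touches at most 2e vertices.
    size-untouched : ∀ {k t} (s : Fin n → Bool) → edgeDiff G H ≤ k → 2 * k + t ≤ size s →
      t ≤ size (UntouchedIn s)
    size-untouched {k} {t} s diff≤k big = +-cancelˡ-≤ (2 * k) t _ (begin
      2 * k + t                                      ≤⟨ big ⟩
      size s                                         ≤⟨ sum-mono-≤ (indicator≤untouched+degree s) ⟩
      sum (λ u → indicator (UntouchedIn s u) + editDegree G H u) ≡⟨ ∑-distrib-+ _ (editDegree G H) ⟩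
      size (UntouchedIn s) + sum (editDegree G H)    ≡⟨ cong (size (UntouchedIn s) +_) (sum-editDegree G H) ⟩
      size (UntouchedIn s) + 2 * edgeDiff G H        ≤⟨ +-monoʳ-≤ (size (UntouchedIn s)) (*-monoʳ-≤ 2 diff≤k) ⟩
      size (UntouchedIn s) + 2 * k                   ≡⟨ +-comm _ (2 * k) ⟩
      2 * k + size (UntouchedIn s)                   ∎)
      where open ≤-Reasoning

  ∃-untouched : ∀ {k} (s : Fin n → Bool) → edgeDiff G H ≤ k → 2 * k + 1 ≤ size s →
    ∃[ u ] (s u ≡ true × Untouched G H u)
  ∃-untouched s diff≤k big =
    let u , uᵤ = size>0⇒∃ (UntouchedIn s) (size-untouched s diff≤k big) in u , untouchedIn⇒ s uᵤ

  ∃₂-untouched : ∀ {k} (s : Fin n → Bool) → edgeDiff G H ≤ k → 2 * k + 2 ≤ size s →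
    ∃[ u ] ∃[ w ] (u ≢ w × (s u ≡ true × Untouched G H u) × (s w ≡ true × Untouched G H w))
  ∃₂-untouched s diff≤k big =
    let u , w , u≢w , uᵤ , u-w = size>1⇒∃₂ (UntouchedIn s) (size-untouched s diff≤k big)
    in u , w , u≢w , untouchedIn⇒ s uᵤ , untouchedIn⇒ s u-w

-- Induced copies of P4 and C4

record IsInducedCopy {m n} (P : Graph m) (H : Graph n) (x : Fin m → Fin n) : Set where
  constructor _,_
  field
    injective : Injective _≡_ _≡_ x
    adjacency : ∀ p q → adj H (x p) (x q) ≡ adj P p q
open IsInducedCopy public

CopyFree : ∀ {m n} → Graph m → Graph n → Set
CopyFree P H = ∀ x → ¬ IsInducedCopy P H x

module _ {m n} {P : Graph m} {H : Graph n} {x : Fin m → Fin n} (copy : IsInducedCopy P H x) where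

  copy-distinct : ∀ p q → p ≢ q → x p ≢ x q
  copy-distinct p q p≢q = p≢q ∘ injective copy

  copy-edge : ∀ p q → E P p q → E H (x p) (x q)
  copy-edge p q e = trans (adjacency copy p q) e

  copy-nonedge : ∀ p q → ¬ E P p q → ¬ E H (x p) (x q)
  copy-nonedge p q ¬e e = ¬e (trans (sym (adjacency copy p q)) e)

copy-∘-injective : ∀ {l m n} {P : Graph l} (H : Graph n) {f : Fin m → Fin n} {x : Fin l → Fin m} →
  Injective _≡_ _≡_ f → IsInducedCopy P (induce H f) x → IsInducedCopy P H (f ∘ x)
copy-∘-injective H f-inj (x-inj , x-adj) = x-inj ∘ f-inj , x-adj

copy-cong : ∀ {m n} {P : Graph m} {G H : Graph n} {x : Fin m → Fin n} →
  (∀ p q → adj H (x p) (x q) ≡ adj G (x p) (x q)) → IsInducedCopy P H x → IsInducedCopy P G x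
copy-cong H≡G copy = injective copy , λ p q → trans (sym (H≡G p q)) (adjacency copy p q)

_⇔?_ : ∀ {A B : Set} → Dec A → Dec B → Dec (A ⇔ B)
a? ⇔? b? = map′ (λ (to , from) → mk⇔ to from) (λ e → Equivalence.to e , Equivalence.from e)
                ((a? →-dec b?) ×-dec (b? →-dec a?))

allSubsets? : ∀ {n} {P : Pred (Subset n) 0ℓ} → Decidable P → Dec (∀ S → P S)
allSubsets? P? = map′ (λ ¬∃¬ S → decidable-stable (P? S) (λ ¬p → ¬∃¬ (S , ¬p)))
                      (λ ∀P (S , ¬p) → ¬p (∀P S))
                      (¬? (anySubset? (¬? ∘ P?)))

E? : ∀ {n} (G : Graph n) u v → Dec (E G u v)
E? G u v = adj G u v ≟ᵇ true

IsModule? : ∀ {n} (G : Graph n) S → Dec (IsModule G S)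
IsModule? G S = all? λ u → all? λ v → all? λ w →
  u ∈? S →-dec v ∈? S →-dec ¬? (w ∈? S) →-dec (E? G u w ⇔? E? G v w)

IsIndependent? : ∀ {n} (G : Graph n) S → Dec (IsIndependent G S)
IsIndependent? G S = all? λ u → all? λ v → u ∈? S →-dec v ∈? S →-dec ¬? (E? G u v)

data Obstruction : Set where
  P4 C4 : Obstruction

private
  path : Fin 4 → Fin 4 → Bool
  path 0F 1F = true
  path 1F 0F = true
  path 1F 2F = true
  path 2F 1F = true
  path 2F 3F = true
  path 3F 2F = true
  path _  _  = false

  cycle : Fin 4 → Fin 4 → Bool
  cycle 3F 0F = true
  cycle 0F 3F = true
  cycle p  q  = path p q

shape : Obstruction → Graph 4
shape P4 = record { adj = path  ; sym = from-yes (all? λ u → all? λ v → path u v ≟ᵇ path v u)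
                                ; irrefl = from-yes (all? λ u → path u u ≟ᵇ false) }
shape C4 = record { adj = cycle ; sym = from-yes (all? λ u → all? λ v → cycle u v ≟ᵇ cycle v u)
                                ; irrefl = from-yes (all? λ u → cycle u u ≟ᵇ false) }

half : Fin 4 → Bool
half p = toℕ p <ᵇ 2

sameHalf⇒adjacent : ∀ O p q → p ≢ q → half p ≡ half q → E (shape O) p q
sameHalf⇒adjacent P4 = from-yes (all? λ p → all? λ q → ¬? (p ≟ q) →-dec half p ≟ᵇ half q →-dec E? (shape P4) p q)
sameHalf⇒adjacent C4 = from-yes (all? λ p → all? λ q → ¬? (p ≟ q) →-dec half p ≟ᵇ half q →-dec E? (shape C4) p q)

adjacent⇒distinguished : ∀ O p q → E (shape O) p q →
  ∃[ r ] (r ≢ p × r ≢ q × adj (shape O) p r ≢ adj (shape O) q r)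
adjacent⇒distinguished P4 = from-yes (all? λ p → all? λ q → E? (shape P4) p q →-dec any? λ r →
  ¬? (r ≟ p) ×-dec ¬? (r ≟ q) ×-dec ¬? (adj (shape P4) p r ≟ᵇ adj (shape P4) q r))
adjacent⇒distinguished C4 = from-yes (all? λ p → all? λ q → E? (shape C4) p q →-dec any? λ r →
  ¬? (r ≟ p) ×-dec ¬? (r ≟ q) ×-dec ¬? (adj (shape C4) p r ≟ᵇ adj (shape C4) q r))

properModule⇒independent : ∀ O S → IsModule (shape O) S → ∃[ r ] r ∉ S → IsIndependent (shape O) S
properModule⇒independent P4 = from-yes (allSubsets? λ S →
  IsModule? (shape P4) S →-dec any? (λ r → ¬? (r ∈? S)) →-dec IsIndependent? (shape P4) S)
properModule⇒independent C4 = from-yes (allSubsets? λ S →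
  IsModule? (shape C4) S →-dec any? (λ r → ¬? (r ∈? S)) →-dec IsIndependent? (shape C4) S)

fin4-pairwise : {R : Fin 4 → Fin 4 → Set} → (∀ {p q} → R p q → R q p) → (∀ p → R p p) →
  R 0F 1F → R 0F 2F → R 0F 3F → R 1F 2F → R 1F 3F → R 2F 3F → ∀ p q → R p q
fin4-pairwise R-sym R-refl r01 r02 r03 r12 r13 r23 = λ where
  0F 0F → R-refl 0F ; 0F 1F → r01        ; 0F 2F → r02        ; 0F 3F → r03
  1F 0F → R-sym r01 ; 1F 1F → R-refl 1F  ; 1F 2F → r12        ; 1F 3F → r13
  2F 0F → R-sym r02 ; 2F 1F → R-sym r12  ; 2F 2F → R-refl 2F  ; 2F 3F → r23
  3F 0F → R-sym r03 ; 3F 1F → R-sym r13  ; 3F 2F → R-sym r23  ; 3F 3F → R-refl 3F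

module _ {n} (G : Graph n) where

  private
    distinct⇒injective : ∀ {a b c d : Fin n} → Distinct4 a b c d → Injective _≡_ _≡_ (a ∷ b ∷ c ∷ d ∷ [])
    distinct⇒injective {a} {b} {c} {d} (a≢b , a≢c , a≢d , b≢c , b≢d , c≢d) {p} {q} =
      fin4-pairwise {R = λ p q → x p ≡ x q → p ≡ q} (λ r → sym ∘ r ∘ sym) (λ _ _ → refl)
        (⊥-elim ∘ a≢b) (⊥-elim ∘ a≢c) (⊥-elim ∘ a≢d) (⊥-elim ∘ b≢c) (⊥-elim ∘ b≢d) (⊥-elim ∘ c≢d) p q
      where x = a ∷ b ∷ c ∷ d ∷ []

    pairwiseAdjacency : (P : Graph 4) (x : Fin 4 → Fin n) →
      adj G (x 0F) (x 1F) ≡ adj P 0F 1F → adj G (x 0F) (x 2F) ≡ adj P 0F 2F →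
      adj G (x 0F) (x 3F) ≡ adj P 0F 3F → adj G (x 1F) (x 2F) ≡ adj P 1F 2F →
      adj G (x 1F) (x 3F) ≡ adj P 1F 3F → adj G (x 2F) (x 3F) ≡ adj P 2F 3F →
      ∀ p q → adj G (x p) (x q) ≡ adj P p q
    pairwiseAdjacency P x = fin4-pairwise {R = λ p q → adj G (x p) (x q) ≡ adj P p q}
      (λ {p} {q} r → trans (Graph.sym G (x q) (x p)) (trans r (Graph.sym P p q)))
      (λ p → trans (irrefl G (x p)) (sym (irrefl P p)))

  InducedP4⇒copy : ∀ {a b c d} → InducedP4 G a b c d → IsInducedCopy (shape P4) G (a ∷ b ∷ c ∷ d ∷ [])
  InducedP4⇒copy (distinct , ab , bc , cd , ¬ac , ¬bd , ¬ad) = distinct⇒injective distinct ,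
    pairwiseAdjacency (shape P4) _ ab (¬-not ¬ac) (¬-not ¬ad) bc (¬-not ¬bd) cd

  InducedC4⇒copy : ∀ {a b c d} → InducedC4 G a b c d → IsInducedCopy (shape C4) G (a ∷ b ∷ c ∷ d ∷ [])
  InducedC4⇒copy (distinct , ab , bc , cd , da , ¬ac , ¬bd) = distinct⇒injective distinct ,
    pairwiseAdjacency (shape C4) _ ab (¬-not ¬ac) (trans (Graph.sym G _ _) da) bc (¬-not ¬bd) cd

  copy⇒InducedP4 : ∀ {x} → IsInducedCopy (shape P4) G x → InducedP4 G (x 0F) (x 1F) (x 2F) (x 3F)
  copy⇒InducedP4 copy =
    (distinct 0F 1F (λ ()) , distinct 0F 2F (λ ()) , distinct 0F 3F (λ ()) ,
     distinct 1F 2F (λ ()) , distinct 1F 3F (λ ()) , distinct 2F 3F (λ ())) ,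
    copy-edge copy 0F 1F refl , copy-edge copy 1F 2F refl , copy-edge copy 2F 3F refl ,
    copy-nonedge copy 0F 2F (λ ()) , copy-nonedge copy 1F 3F (λ ()) , copy-nonedge copy 0F 3F (λ ())
    where distinct = copy-distinct copy

  copy⇒InducedC4 : ∀ {x} → IsInducedCopy (shape C4) G x → InducedC4 G (x 0F) (x 1F) (x 2F) (x 3F)
  copy⇒InducedC4 copy =
    (distinct 0F 1F (λ ()) , distinct 0F 2F (λ ()) , distinct 0F 3F (λ ()) ,
     distinct 1F 2F (λ ()) , distinct 1F 3F (λ ()) , distinct 2F 3F (λ ())) ,
    copy-edge copy 0F 1F refl , copy-edge copy 1F 2F refl , copy-edge copy 2F 3F refl , copy-edge copy 3F 0F refl ,
    copy-nonedge copy 0F 2F (λ ()) , copy-nonedge copy 1F 3F (λ ())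
    where distinct = copy-distinct copy

  TriviallyPerfectOn⇒copyFree : ∀ {S} → TriviallyPerfectOn G S →
    ∀ O x → (∀ p → x p ∈ S) → ¬ IsInducedCopy (shape O) G x
  TriviallyPerfectOn⇒copyFree tp P4 x x∈S copy =
    proj₁ (tp _ _ _ _ (x∈S 0F) (x∈S 1F) (x∈S 2F) (x∈S 3F)) (copy⇒InducedP4 copy)
  TriviallyPerfectOn⇒copyFree tp C4 x x∈S copy =
    proj₂ (tp _ _ _ _ (x∈S 0F) (x∈S 1F) (x∈S 2F) (x∈S 3F)) (copy⇒InducedC4 copy)

  TriviallyPerfect⇒copyFree : TriviallyPerfect G → ∀ O → CopyFree (shape O) G
  TriviallyPerfect⇒copyFree tp O x = TriviallyPerfectOn⇒copyFree {⊤} (λ a b c d _ _ _ _ → tp a b c d) O x (λ _ → ∈⊤)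

  copyFree⇒TriviallyPerfect : (∀ O → CopyFree (shape O) G) → TriviallyPerfect G
  copyFree⇒TriviallyPerfect free a b c d =
    (λ p4 → free P4 _ (InducedP4⇒copy p4)) , (λ c4 → free C4 _ (InducedC4⇒copy c4))

TriviallyPerfectOn-cong : ∀ {n} {G H : Graph n} {M : Subset n} →
  (∀ {x y} → x ∈ M → y ∈ M → adj H x y ≡ adj G x y) → TriviallyPerfectOn G M → TriviallyPerfectOn H M
TriviallyPerfectOn-cong {G = G} {H} {M} H≡G tpG a b c d a∈M b∈M c∈M d∈M =
  (λ p4 → free P4 (copy-cong agree (InducedP4⇒copy H p4))) ,
  (λ c4 → free C4 (copy-cong agree (InducedC4⇒copy H c4)))
  where
  x = a ∷ b ∷ c ∷ d ∷ []
  x∈M : ∀ p → x p ∈ M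
  x∈M = λ where 0F → a∈M ; 1F → b∈M ; 2F → c∈M ; 3F → d∈M
  agree : ∀ p q → adj H (x p) (x q) ≡ adj G (x p) (x q)
  agree p q = H≡G (x∈M p) (x∈M q)
  free : ∀ O → ¬ IsInducedCopy (shape O) G x
  free O = TriviallyPerfectOn⇒copyFree G tpG O x x∈M

-- Restricting and lifting solutions

module _ {m n} {f : Fin m → Fin n} (f-inj : Injective _≡_ _≡_ f) where

  TriviallyPerfect-induce : ∀ (H : Graph n) → TriviallyPerfect H → TriviallyPerfect (induce H f)
  TriviallyPerfect-induce H tp = copyFree⇒TriviallyPerfect (induce H f) λ O x copy →
    TriviallyPerfect⇒copyFree H tp O (f ∘ x) (copy-∘-injective H f-inj copy)

  edgeDiff-induce-≤ : ∀ (G H : Graph n) → edgeDiff (induce G f) (induce H f) ≤ edgeDiff G H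
  edgeDiff-induce-≤ G H = *-cancelˡ-≤ 2 (subst₂ _≤_
    (sum-editDegree (induce G f) (induce H f)) (sum-editDegree G H)
    (sum₂-∘-injective-≤ (disagreement G H) f-inj))

  TPDeletion-induce : ∀ {G k} → TPDeletion G k → TPDeletion (induce G f) k
  TPDeletion-induce {G} (H , H⊑G , diff≤k , tp) =
    induce H f , (λ i j → H⊑G (f i) (f j)) , ≤-trans (edgeDiff-induce-≤ G H) diff≤k , TriviallyPerfect-induce H tp

  TPCompletion-induce : ∀ {G k} → TPCompletion G k → TPCompletion (induce G f) k
  TPCompletion-induce {G} (H , G⊑H , diff≤k , tp) =
    induce H f , (λ i j → G⊑H (f i) (f j)) , ≤-trans (edgeDiff-induce-≤ G H) diff≤k , TriviallyPerfect-induce H tp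

record IsLift {m n} (G H : Graph n) (H′ : Graph m) (f : Fin m → Fin n) (π : Fin n → Fin m) : Set where
  constructor mkLift
  field
    agrees-or-copies : ∀ x y →
      adj H x y ≡ adj G x y ⊎ (f (π x) ≡ x × f (π y) ≡ y × adj H x y ≡ adj H′ (π x) (π y))

module _ {m n} {G H : Graph n} {H′ : Graph m} {f : Fin m → Fin n} {π : Fin n → Fin m}
         (lift : IsLift G H H′ f π) where

  open IsLift lift

  private
    agreement⇒no-disagreement : ∀ {x y} → adj H x y ≡ adj G x y → disagreement G H x y ≡ 0
    agreement⇒no-disagreement {x} {y} H≡G rewrite H≡G = cong indicator (xor-same (adj G x y))

  edgeDiff-lift-≤ : Injective _≡_ _≡_ f → edgeDiff G H ≤ edgeDiff (induce G f) H′
  edgeDiff-lift-≤ f-inj = *-cancelˡ-≤ 2 (subst₂ _≤_ (sum-editDegree G H) (sum-editDegree (induce G f) H′) (begin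
    sum₂ (disagreement G H)                                ≤⟨ sum₂-≤-∘-injective (disagreement G H) f-inj inImage ⟩
    sum₂ (λ i j → disagreement G H (f i) (f j))            ≤⟨ sum-mono-≤ (λ i → sum-mono-≤ (disagreement-≤ i)) ⟩
    sum₂ (disagreement (induce G f) H′)                    ∎))
    where
    open ≤-Reasoning
    inImage : ∀ x y → 0 < disagreement G H x y → (∃[ i ] f i ≡ x) × (∃[ j ] f j ≡ y)
    inImage x y pos with agrees-or-copies x y
    ... | inj₂ (fπx≡x , fπy≡y , _) = (π x , fπx≡x) , (π y , fπy≡y)
    ... | inj₁ H≡G = ⊥-elim (<-irrefl refl (subst (0 <_) (agreement⇒no-disagreement H≡G) pos))
    disagreement-≤ : ∀ i j → disagreement G H (f i) (f j) ≤ disagreement (induce G f) H′ i j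
    disagreement-≤ i j with agrees-or-copies (f i) (f j)
    ... | inj₁ H≡G = subst (_≤ _) (sym (agreement⇒no-disagreement H≡G)) z≤n
    ... | inj₂ (fπi≡fi , fπj≡fj , H≡H′) rewrite H≡H′ | f-inj fπi≡fi | f-inj fπj≡fj = ≤-refl

  lift-⊑ : H′ ⊑ induce G f → H ⊑ G
  lift-⊑ H′⊑G x y e with agrees-or-copies x y
  ... | inj₁ H≡G = trans (sym H≡G) e
  ... | inj₂ (fπx≡x , fπy≡y , H≡H′) =
    subst₂ (E G) fπx≡x fπy≡y (H′⊑G (π x) (π y) (trans (sym H≡H′) e))

  lift-⊒ : induce G f ⊑ H′ → G ⊑ H
  lift-⊒ G⊑H′ x y e with agrees-or-copies x y
  ... | inj₁ H≡G = trans H≡G e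
  ... | inj₂ (fπx≡x , fπy≡y , H≡H′) =
    trans H≡H′ (G⊑H′ (π x) (π y) (subst₂ (E G) (sym fπx≡x) (sym fπy≡y) e))

SafeRestriction : ∀ {m n} → Graph n → (Fin m → Fin n) → ℕ → Set
SafeRestriction G f k =
  (TPDeletion G k ⇔ TPDeletion (induce G f) k) × (TPCompletion G k ⇔ TPCompletion (induce G f) k)

Liftable : ∀ {m n} → Graph n → (Fin m → Fin n) → ℕ → Set
Liftable {m} {n} G f k = ∀ H′ → edgeDiff (induce G f) H′ ≤ k → TriviallyPerfect H′ →
  ∃[ H ] ∃[ π ] (IsLift G H H′ f π × TriviallyPerfect H)

liftable⇒safe : ∀ {m n} {G : Graph n} {f : Fin m → Fin n} {k} →
  Injective _≡_ _≡_ f → Liftable G f k → SafeRestriction G f k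
liftable⇒safe {G = G} f-inj liftable =
  mk⇔ (TPDeletion-induce f-inj {G}) (λ (H′ , H′⊑G , diff≤k , tp) →
    let H , _ , lift , tpH = liftable H′ diff≤k tp
    in H , lift-⊑ lift H′⊑G , ≤-trans (edgeDiff-lift-≤ lift f-inj) diff≤k , tpH) ,
  mk⇔ (TPCompletion-induce f-inj {G}) (λ (H′ , G⊑H′ , diff≤k , tp) →
    let H , _ , lift , tpH = liftable H′ diff≤k tp
    in H , lift-⊒ lift G⊑H′ , ≤-trans (edgeDiff-lift-≤ lift f-inj) diff≤k , tpH)

-- Blowing up vertices into cliques

closedAdj : ∀ {n} → Graph n → Fin n → Fin n → Bool
closedAdj H i j = does (i ≟ j) ∨ adj H i j

does-≟-sym : ∀ {n} (i j : Fin n) → does (i ≟ j) ≡ does (j ≟ i)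
does-≟-sym i j with i ≟ j | j ≟ i
... | yes _   | yes _   = refl
... | no _    | no _    = refl
... | yes i≡j | no j≢i  = ⊥-elim (j≢i (sym i≡j))
... | no i≢j  | yes j≡i = ⊥-elim (i≢j (sym j≡i))

module _ {n} (H : Graph n) where

  closedAdj-sym : ∀ i j → closedAdj H i j ≡ closedAdj H j i
  closedAdj-sym i j = cong₂ _∨_ (does-≟-sym i j) (Graph.sym H i j)

  closedAdj-refl : ∀ i → closedAdj H i i ≡ true
  closedAdj-refl i = cong (_∨ adj H i i) (dec-true (i ≟ i) refl)

  closedAdj-distinct : ∀ {i j} → i ≢ j → closedAdj H i j ≡ adj H i j
  closedAdj-distinct {i} {j} i≢j = cong (_∨ adj H i j) (dec-false (i ≟ j) i≢j)

cliqueBlowUp : ∀ {m n} → Graph m → (Fin n → Fin m) → Graph n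
cliqueBlowUp H π = record
  { adj    = λ x y → not (does (x ≟ y)) ∧ closedAdj H (π x) (π y)
  ; sym    = λ x y → cong₂ _∧_ (cong not (does-≟-sym x y)) (closedAdj-sym H (π x) (π y))
  ; irrefl = λ x → cong (λ b → not b ∧ closedAdj H (π x) (π x)) (dec-true (x ≟ x) refl)
  }

module _ {m n} (H : Graph m) (π : Fin n → Fin m) where

  cliqueBlowUp-distinct : ∀ {x y} → x ≢ y → adj (cliqueBlowUp H π) x y ≡ closedAdj H (π x) (π y)
  cliqueBlowUp-distinct {x} {y} x≢y = cong (λ b → not b ∧ closedAdj H (π x) (π y)) (dec-false (x ≟ y) x≢y)

  -- Two vertices of a copy in one fiber of π would be adjacent twins of the pattern.
  copyFree-cliqueBlowUp : ∀ O → CopyFree (shape O) H → CopyFree (shape O) (cliqueBlowUp H π)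
  copyFree-cliqueBlowUp O free x copy = free (π ∘ x) (πx-injective , πx-adjacency)
    where
    P = shape O

    adj-fibers : ∀ p q → p ≢ q → adj P p q ≡ closedAdj H (π (x p)) (π (x q))
    adj-fibers p q p≢q = trans (sym (adjacency copy p q)) (cliqueBlowUp-distinct (copy-distinct copy p q p≢q))

    πx-injective : Injective _≡_ _≡_ (π ∘ x)
    πx-injective {p} {q} same-fiber with p ≟ q
    ... | yes p≡q = p≡q
    ... | no p≢q  = ⊥-elim (differ (begin
      adj P p r                          ≡⟨ adj-fibers p r (r≢p ∘ sym) ⟩
      closedAdj H (π (x p)) (π (x r))    ≡⟨ cong (λ i → closedAdj H i (π (x r))) same-fiber ⟩
      closedAdj H (π (x q)) (π (x r))    ≡⟨ adj-fibers q r (r≢q ∘ sym) ⟨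
      adj P q r                          ∎))
      where
      open ≡-Reasoning
      pq-adjacent : E P p q
      pq-adjacent = trans (adj-fibers p q p≢q) (trans (cong (closedAdj H (π (x p))) (sym same-fiber)) (closedAdj-refl H _))
      distinguished = adjacent⇒distinguished O p q pq-adjacent
      r = proj₁ distinguished
      r≢p = proj₁ (proj₂ distinguished)
      r≢q = proj₁ (proj₂ (proj₂ distinguished))
      differ = proj₂ (proj₂ (proj₂ distinguished))

    πx-adjacency : ∀ p q → adj H (π (x p)) (π (x q)) ≡ adj P p q
    πx-adjacency p q with p ≟ q
    ... | yes refl = trans (irrefl H _) (sym (irrefl P p))
    ... | no p≢q   = trans (sym (closedAdj-distinct H (p≢q ∘ πx-injective))) (sym (adj-fibers p q p≢q))

  TriviallyPerfect-cliqueBlowUp : TriviallyPerfect H → TriviallyPerfect (cliqueBlowUp H π)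
  TriviallyPerfect-cliqueBlowUp tp = copyFree⇒TriviallyPerfect (cliqueBlowUp H π) λ O →
    copyFree-cliqueBlowUp O (TriviallyPerfect⇒copyFree H tp O)

-- Replacing a module

pullback : ∀ {m n} → (Fin m → Fin n) → Subset n → Subset m
pullback x M = tabulate (λ p → does (x p ∈? M))

module _ {m n} (x : Fin m → Fin n) {M : Subset n} where

  ∈-pullback⁻ : ∀ {p} → p ∈ pullback x M → x p ∈ M
  ∈-pullback⁻ {p} p∈S with x p ∈? M | trans (sym (lookup∘tabulate _ p)) ([]=⇒lookup p∈S)
  ... | yes xp∈M | _  = xp∈M
  ... | no _     | ()

  ∈-pullback⁺ : ∀ {p} → x p ∈ M → p ∈ pullback x M
  ∈-pullback⁺ {p} xp∈M = lookup⇒[]= p (pullback x M) (trans (lookup∘tabulate _ p) (dec-true (x p ∈? M) xp∈M))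

module _ {m n} (H : Graph n) (M : Subset n) (H′ : Graph m) (ρ : Fin n → Fin m) (w : Bool → Fin m)
  (w-injective : w true ≢ w false) (w-nonadjacent : ¬ E H′ (w true) (w false))
  (outside : ∀ {x y} → x ∉ M → y ∉ M → adj H x y ≡ adj H′ (ρ x) (ρ y))
  (across : ∀ b {x y} → x ∈ M → y ∉ M → adj H x y ≡ adj H′ (w b) (ρ y))
  (ρ-injective : ∀ {x y} → x ∉ M → y ∉ M → ρ x ≡ ρ y → x ≡ y)
  (ρ-avoids-w : ∀ b {x} → x ∉ M → ρ x ≢ w b) where

  private
    w-cancel : ∀ {b c} → w b ≡ w c → b ≡ c
    w-cancel {true}  {true}  _ = refl
    w-cancel {false} {false} _ = refl
    w-cancel {true}  {false} e = ⊥-elim (w-injective e)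
    w-cancel {false} {true}  e = ⊥-elim (w-injective (sym e))

    w-independent : ∀ b c → b ≢ c → adj H′ (w b) (w c) ≡ false
    w-independent true  true  b≢c = ⊥-elim (b≢c refl)
    w-independent false false b≢c = ⊥-elim (b≢c refl)
    w-independent true  false _   = ¬-not w-nonadjacent
    w-independent false true  _   = trans (Graph.sym H′ _ _) (¬-not w-nonadjacent)

  -- The vertices of a copy that lie in M form a module of the pattern.
  partialCopy-independent : ∀ O {x} → IsInducedCopy (shape O) H x → ∃[ r ] x r ∉ M →
    ∀ p q → x p ∈ M → x q ∈ M → ¬ E (shape O) p q
  partialCopy-independent O {x} copy (r , xr∉M) p q xp∈M xq∈M =
    properModule⇒independent O S S-module (r , xr∉M ∘ ∈-pullback⁻ x) p q (∈-pullback⁺ x xp∈M) (∈-pullback⁺ x xq∈M)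
    where
    P = shape O
    S = pullback x M
    S-module : IsModule P S
    S-module a b r a∈S b∈S r∉S = mk⇔ (trans (sym same)) (trans same)
      where
      open ≡-Reasoning
      xr∉M′ = r∉S ∘ ∈-pullback⁺ x
      same : adj P a r ≡ adj P b r
      same = begin
        adj P a r                  ≡⟨ adjacency copy a r ⟨
        adj H (x a) (x r)          ≡⟨ across true (∈-pullback⁻ x a∈S) xr∉M′ ⟩
        adj H′ (w true) (ρ (x r))  ≡⟨ across true (∈-pullback⁻ x b∈S) xr∉M′ ⟨
        adj H (x b) (x r)          ≡⟨ adjacency copy b r ⟩
        adj P b r                  ∎

  -- The vertices of a partial copy lying in M are independent, so no two of them lie in the same
  -- half (a clique) of the pattern; sending them to w (half p) gives a copy in H′.
  copyFree-replaceModule : ∀ O → (∀ x → (∀ p → x p ∈ M) → ¬ IsInducedCopy (shape O) H x) →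
    CopyFree (shape O) H′ → CopyFree (shape O) H
  copyFree-replaceModule O inside free x copy with all? (λ p → x p ∈? M)
  ... | yes all-in = inside x all-in copy
  ... | no ¬all-in = free ψ (ψ-injective , ψ-adjacency)
    where
    P = shape O

    independent : ∀ p q → x p ∈ M → x q ∈ M → ¬ E P p q
    independent = partialCopy-independent O copy (¬∀⟶∃¬ 4 _ (λ p → x p ∈? M) ¬all-in)

    represent : ∀ p → Dec (x p ∈ M) → Fin m
    represent p (yes _) = w (half p)
    represent p (no _)  = ρ (x p)

    ψ : Fin 4 → Fin m
    ψ p = represent p (x p ∈? M)

    halves-differ : ∀ {p q} → p ≢ q → x p ∈ M → x q ∈ M → half p ≢ half q
    halves-differ {p} {q} p≢q xp∈M xq∈M same = independent p q xp∈M xq∈M (sameHalf⇒adjacent O p q p≢q same)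

    ψ-injective : Injective _≡_ _≡_ ψ
    ψ-injective {p} {q} eq with x p ∈? M | x q ∈? M
    ... | yes xp∈M | yes xq∈M with p ≟ q
    ...   | yes p≡q = p≡q
    ...   | no p≢q  = ⊥-elim (halves-differ p≢q xp∈M xq∈M (w-cancel eq))
    ψ-injective eq | yes _   | no xq∉M = ⊥-elim (ρ-avoids-w _ xq∉M (sym eq))
    ψ-injective eq | no xp∉M | yes _   = ⊥-elim (ρ-avoids-w _ xp∉M eq)
    ψ-injective eq | no xp∉M | no xq∉M = injective copy (ρ-injective xp∉M xq∉M eq)

    ψ-adjacency : ∀ p q → adj H′ (ψ p) (ψ q) ≡ adj P p q
    ψ-adjacency p q with x p ∈? M | x q ∈? M
    ... | yes xp∈M | yes xq∈M with p ≟ q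
    ...   | yes refl = trans (irrefl H′ _) (sym (irrefl P p))
    ...   | no p≢q   = trans (w-independent _ _ (halves-differ p≢q xp∈M xq∈M))
                             (sym (¬-not (independent p q xp∈M xq∈M)))
    ψ-adjacency p q | yes xp∈M | no xq∉M =
      trans (sym (across (half p) xp∈M xq∉M)) (adjacency copy p q)
    ψ-adjacency p q | no xp∉M | yes xq∈M = begin
      adj H′ (ρ (x p)) (w (half q))  ≡⟨ Graph.sym H′ _ _ ⟩
      adj H′ (w (half q)) (ρ (x p))  ≡⟨ across (half q) xq∈M xp∉M ⟨
      adj H (x q) (x p)              ≡⟨ Graph.sym H _ _ ⟩
      adj H (x p) (x q)              ≡⟨ adjacency copy p q ⟩
      adj P p q                      ∎
      where open ≡-Reasoning
    ψ-adjacency p q | no xp∉M | no xq∉M = trans (sym (outside xp∉M xq∉M)) (adjacency copy p q)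

  TriviallyPerfect-replaceModule : TriviallyPerfectOn H M → TriviallyPerfect H′ → TriviallyPerfect H
  TriviallyPerfect-replaceModule tpM tp = copyFree⇒TriviallyPerfect H λ O →
    copyFree-replaceModule O (TriviallyPerfectOn⇒copyFree H tpM O) (TriviallyPerfect⇒copyFree H′ tp O)

graft : ∀ {m n} → Graph n → Subset n → Graph m → (Fin n → Fin m) → Graph n
graft G M H π = record { adj = adj′ ; sym = sym′ ; irrefl = irrefl′ }
  where
  inM : _ → Bool
  inM x = does (x ∈? M)
  adj′ : _ → _ → Bool
  adj′ x y = if inM x ∧ inM y then adj G x y else adj H (π x) (π y)
  sym′ : ∀ x y → adj′ x y ≡ adj′ y x
  sym′ x y rewrite ∧-comm (inM x) (inM y) | Graph.sym G x y | Graph.sym H (π x) (π y) = refl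
  irrefl′ : ∀ x → adj′ x x ≡ false
  irrefl′ x with inM x
  ... | true  = irrefl G x
  ... | false = irrefl H (π x)

module _ {m n} (G : Graph n) (M : Subset n) (H : Graph m) (π : Fin n → Fin m) where

  graft-inside : ∀ {x y} → x ∈ M → y ∈ M → adj (graft G M H π) x y ≡ adj G x y
  graft-inside {x} {y} x∈M y∈M rewrite dec-true (x ∈? M) x∈M | dec-true (y ∈? M) y∈M = refl

  graft-outsideˡ : ∀ {x y} → x ∉ M → adj (graft G M H π) x y ≡ adj H (π x) (π y)
  graft-outsideˡ {x} x∉M rewrite dec-false (x ∈? M) x∉M = refl

  graft-outsideʳ : ∀ {x y} → y ∉ M → adj (graft G M H π) x y ≡ adj H (π x) (π y)
  graft-outsideʳ {x} {y} y∉M rewrite dec-false (y ∈? M) y∉M | ∧-zeroʳ (does (x ∈? M)) = refl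

-- The two rules

≡true⇔⇒≡ : ∀ {a b} → (a ≡ true ⇔ b ≡ true) → a ≡ b
≡true⇔⇒≡ {true}  {true}  _ = refl
≡true⇔⇒≡ {false} {false} _ = refl
≡true⇔⇒≡ {true}  {false} a⇔b = sym (Equivalence.to a⇔b refl)
≡true⇔⇒≡ {false} {true}  a⇔b = Equivalence.from a⇔b refl

module _ {n} (G : Graph n) {u v : Fin n} (twins : TrueTwins G u v) where

  trueTwins⇒adjacent : u ≢ v → E G u v
  trueTwins⇒adjacent u≢v with Equivalence.from (twins v) (inj₁ refl)
  ... | inj₁ v≡u  = ⊥-elim (u≢v (sym v≡u))
  ... | inj₂ u~v  = u~v

  trueTwins⇒sameAdj : ∀ {y} → y ≢ u → y ≢ v → adj G u y ≡ adj G v y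
  trueTwins⇒sameAdj {y} y≢u y≢v = ≡true⇔⇒≡ (mk⇔
    (λ u~y → [ ⊥-elim ∘ y≢v , id ]′ (Equivalence.to (twins y) (inj₂ u~y)))
    (λ v~y → [ ⊥-elim ∘ y≢u , id ]′ (Equivalence.from (twins y) (inj₂ v~y))))

retract : ∀ {n} → Fin (suc n) → Fin n → Fin (suc n) → Fin n
retract v w x with v ≟ x
... | yes _   = w
... | no v≢x  = punchOut v≢x

module _ {n} (v : Fin (suc n)) (w : Fin n) where

  retract-self : retract v w v ≡ w
  retract-self with v ≟ v
  ... | yes _   = refl
  ... | no v≢v  = ⊥-elim (v≢v refl)

  punchIn-retract : ∀ {x} → v ≢ x → punchIn v (retract v w x) ≡ x
  punchIn-retract {x} v≢x with v ≟ x
  ... | yes v≡x  = ⊥-elim (v≢x v≡x)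
  ... | no v≢x′  = punchIn-punchOut v≢x′

  retract-punchIn : ∀ i → retract v w (punchIn v i) ≡ i
  retract-punchIn i = punchIn-injective v _ _ (punchIn-retract (punchInᵢ≢i v i ∘ sym))

module TwinReinsertion {n} (G : Graph (suc n)) (v : Fin (suc n)) (w′ : Fin n) (H′ : Graph n)
  (twins : TrueTwins G v (punchIn v w′)) (w′-untouched : Untouched (delVertex G v) H′ w′) where

  private
    w = punchIn v w′

    v≢w : v ≢ w
    v≢w = punchInᵢ≢i v w′ ∘ sym

  π : Fin (suc n) → Fin n
  π = retract v w′

  H : Graph (suc n)
  H = cliqueBlowUp H′ π

  H-at-v : ∀ y → adj H v y ≡ adj G v y
  H-at-v y = byCases (v ≟ y) (y ≟ w)
    where
    open ≡-Reasoning
    byCases : Dec (v ≡ y) → Dec (y ≡ w) → adj H v y ≡ adj G v y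
    byCases (yes refl) _ = trans (irrefl H v) (sym (irrefl G v))
    byCases (no v≢y) (yes refl) = begin
      adj H v w                        ≡⟨ cliqueBlowUp-distinct H′ π v≢w ⟩
      closedAdj H′ (π v) (π w)         ≡⟨ cong₂ (closedAdj H′) (retract-self v w′) (retract-punchIn v w′ w′) ⟩
      closedAdj H′ w′ w′               ≡⟨ closedAdj-refl H′ w′ ⟩
      true                             ≡⟨ trueTwins⇒adjacent G twins v≢w ⟨
      adj G v w                        ∎
    byCases (no v≢y) (no y≢w) = begin
      adj H v y                        ≡⟨ cliqueBlowUp-distinct H′ π v≢y ⟩
      closedAdj H′ (π v) (π y)         ≡⟨ cong (λ i → closedAdj H′ i (π y)) (retract-self v w′) ⟩
      closedAdj H′ w′ (π y)            ≡⟨ closedAdj-distinct H′ w′≢πy ⟩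
      adj H′ w′ (π y)                  ≡⟨ w′-untouched (π y) ⟩
      adj G w (punchIn v (π y))        ≡⟨ cong (adj G w) (punchIn-retract v w′ v≢y) ⟩
      adj G w y                        ≡⟨ trueTwins⇒sameAdj G twins (v≢y ∘ sym) y≢w ⟨
      adj G v y                        ∎
      where
      w′≢πy : w′ ≢ π y
      w′≢πy w′≡πy = y≢w (trans (sym (punchIn-retract v w′ v≢y)) (cong (punchIn v) (sym w′≡πy)))

  H-lift : IsLift G H H′ (punchIn v) π
  H-lift = mkLift λ x y → byCases (v ≟ x) (v ≟ y) (x ≟ y)
    where
    open ≡-Reasoning
    byCases : ∀ {x y} → Dec (v ≡ x) → Dec (v ≡ y) → Dec (x ≡ y) →
      adj H x y ≡ adj G x y ⊎ (punchIn v (π x) ≡ x × punchIn v (π y) ≡ y × adj H x y ≡ adj H′ (π x) (π y))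
    byCases {y = y} (yes refl) _ _ = inj₁ (H-at-v y)
    byCases {x = x} (no _) (yes refl) _ = inj₁ (trans (Graph.sym H x v) (trans (H-at-v x) (Graph.sym G v x)))
    byCases {x = x} (no _) (no _) (yes refl) = inj₁ (trans (irrefl H x) (sym (irrefl G x)))
    byCases {x} {y} (no v≢x) (no v≢y) (no x≢y) = inj₂ (punchIn-retract v w′ v≢x , punchIn-retract v w′ v≢y ,
      trans (cliqueBlowUp-distinct H′ π x≢y) (closedAdj-distinct H′ (λ πx≡πy → x≢y (begin
        x                    ≡⟨ punchIn-retract v w′ v≢x ⟨
        punchIn v (π x)      ≡⟨ cong (punchIn v) πx≡πy ⟩
        punchIn v (π y)      ≡⟨ punchIn-retract v w′ v≢y ⟩
        y                    ∎))))

trueTwins-liftable : ∀ {n} (G : Graph (suc n)) k (Q : Subset (suc n)) v →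
  PairwiseTrueTwins G Q → 2 * k + 1 < ∣ Q ∣ → v ∈ Q → Liftable G (punchIn v) k
trueTwins-liftable {n} G k Q v twins big v∈Q H′ diff≤k tp =
  let w′ , w∈Q , w′-untouched = ∃-untouched (delVertex G v) H′ inQ diff≤k enough
      open TwinReinsertion G v w′ H′ (twins v (punchIn v w′) v∈Q (lookup⇒[]= _ Q w∈Q)) w′-untouched
  in H , π , H-lift , TriviallyPerfect-cliqueBlowUp H′ π tp
  where
  inQ : Fin n → Bool
  inQ i = lookup Q (punchIn v i)

  enough : 2 * k + 1 ≤ size inQ
  enough = +-cancelˡ-≤ 1 _ _ (begin
    1 + (2 * k + 1)                          ≤⟨ big ⟩
    ∣ Q ∣                                    ≡⟨ ∣-∣≡size Q ⟩
    size (lookup Q)                          ≡⟨ sum-remove {i = v} (indicator ∘ lookup Q) ⟩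
    indicator (lookup Q v) + size inQ        ≤⟨ +-monoˡ-≤ (size inQ) (indicator≤1 (lookup Q v)) ⟩
    1 + size inQ                             ∎)
    where open ≤-Reasoning

module ModuleReinsertion {m n} (G : Graph n) (M I : Subset n) (f : Fin m → Fin n)
  (module′ : IsModule G M) (I⊆M : I ⊆ M) (image : ∀ x → (x ∉ M ⊎ x ∈ I) ⇔ (∃[ i ] f i ≡ x))
  (H′ : Graph m) (w : Bool → Fin m)
  (w∈I : ∀ b → f (w b) ∈ I) (w-untouched : ∀ b → Untouched (induce G f) H′ (w b)) where

  private
    preimage : ∀ {x} → x ∉ M → ∃[ i ] f i ≡ x
    preimage x∉M = Equivalence.to (image _) (inj₁ x∉M)

    choose : ∀ x → Dec (x ∈ M) → Fin m
    choose x (yes _)   = w true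
    choose x (no x∉M)  = proj₁ (preimage x∉M)

  π : Fin n → Fin m
  π x = choose x (x ∈? M)

  f∘π : ∀ {x} → x ∉ M → f (π x) ≡ x
  f∘π {x} x∉M with x ∈? M
  ... | yes x∈M  = ⊥-elim (x∉M x∈M)
  ... | no x∉M′  = proj₂ (preimage x∉M′)

  π-inside : ∀ {x} → x ∈ M → π x ≡ w true
  π-inside {x} x∈M with x ∈? M
  ... | yes _    = refl
  ... | no x∉M   = ⊥-elim (x∉M x∈M)

  π-injective : ∀ {x y} → x ∉ M → y ∉ M → π x ≡ π y → x ≡ y
  π-injective x∉M y∉M πx≡πy = trans (sym (f∘π x∉M)) (trans (cong f πx≡πy) (f∘π y∉M))

  π-avoids-w : ∀ b {x} → x ∉ M → π x ≢ w b
  π-avoids-w b x∉M πx≡wb = x∉M (subst (_∈ M) (trans (cong f (sym πx≡wb)) (f∘π x∉M)) (I⊆M (w∈I b)))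

  H : Graph n
  H = graft G M H′ π

  G-across : ∀ b {x y} → x ∈ M → y ∉ M → adj G x y ≡ adj H′ (w b) (π y)
  G-across b {x} {y} x∈M y∉M = begin
    adj G x y                  ≡⟨ ≡true⇔⇒≡ (module′ x (f (w b)) y x∈M (I⊆M (w∈I b)) y∉M) ⟩
    adj G (f (w b)) y          ≡⟨ cong (adj G (f (w b))) (f∘π y∉M) ⟨
    adj G (f (w b)) (f (π y))  ≡⟨ w-untouched b (π y) ⟨
    adj H′ (w b) (π y)         ∎
    where open ≡-Reasoning

  H-across : ∀ b {x y} → x ∈ M → y ∉ M → adj H x y ≡ adj H′ (w b) (π y)
  H-across b {x} {y} x∈M y∉M = begin
    adj H x y              ≡⟨ graft-outsideʳ G M H′ π y∉M ⟩
    adj H′ (π x) (π y)     ≡⟨ cong (λ i → adj H′ i (π y)) (π-inside x∈M) ⟩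
    adj H′ (w true) (π y)  ≡⟨ G-across true x∈M y∉M ⟨
    adj G x y              ≡⟨ G-across b x∈M y∉M ⟩
    adj H′ (w b) (π y)     ∎
    where open ≡-Reasoning

  H-lift : IsLift G H H′ f π
  H-lift = mkLift λ x y → byCases (x ∈? M) (y ∈? M)
    where
    across : ∀ {x y} → x ∈ M → y ∉ M → adj H x y ≡ adj G x y
    across x∈M y∉M = trans (H-across true x∈M y∉M) (sym (G-across true x∈M y∉M))
    byCases : ∀ {x y} → Dec (x ∈ M) → Dec (y ∈ M) →
      adj H x y ≡ adj G x y ⊎ (f (π x) ≡ x × f (π y) ≡ y × adj H x y ≡ adj H′ (π x) (π y))
    byCases (yes x∈M) (yes y∈M) = inj₁ (graft-inside G M H′ π x∈M y∈M)
    byCases (yes x∈M) (no y∉M)  = inj₁ (across x∈M y∉M)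
    byCases {x} {y} (no x∉M) (yes y∈M) = inj₁ (trans (Graph.sym H x y) (trans (across y∈M x∉M) (Graph.sym G y x)))
    byCases (no x∉M)  (no y∉M)  = inj₂ (f∘π x∉M , f∘π y∉M , graft-outsideˡ G M H′ π x∉M)

independentModule-liftable : ∀ {m n} (G : Graph n) k (M I : Subset n) (f : Fin m → Fin n) →
  IsModule G M → TriviallyPerfectOn G M → I ⊆ M → IsIndependent G I → 2 * k + 2 ≤ ∣ I ∣ →
  Enumerates f (λ x → x ∉ M ⊎ x ∈ I) → Liftable G f k
independentModule-liftable {m} {n} G k M I f module′ tpM I⊆M independent big (f-inj , image) H′ diff≤k tp =
  H , π , H-lift , TriviallyPerfect-replaceModule H M H′ π w w₁≢w₂ w-nonadjacent
    (λ x∉M _ → graft-outsideˡ G M H′ π x∉M) H-across π-injective π-avoids-w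
    (TriviallyPerfectOn-cong {G = G} {H} {M} (graft-inside G M H′ π) tpM) tp
  where
  inI : Fin m → Bool
  inI i = lookup I (f i)

  enough : 2 * k + 2 ≤ size inI
  enough = ≤-trans big (≤-trans (≤-reflexive (∣-∣≡size I)) (sum-≤-∘-injective (indicator ∘ lookup I) f-inj
    (λ u pos → Equivalence.to (image u) (inj₂ (lookup⇒[]= u I (indicator>0 pos))))))

  untouchedPair = ∃₂-untouched (induce G f) H′ inI diff≤k enough
  w₁ = proj₁ untouchedPair
  w₂ = proj₁ (proj₂ untouchedPair)
  w₁≢w₂ = proj₁ (proj₂ (proj₂ untouchedPair))
  facts₁ = proj₁ (proj₂ (proj₂ (proj₂ untouchedPair)))
  facts₂ = proj₂ (proj₂ (proj₂ (proj₂ untouchedPair)))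

  w : Bool → Fin m
  w b = if b then w₁ else w₂

  w∈I : ∀ b → f (w b) ∈ I
  w∈I true  = lookup⇒[]= (f w₁) I (proj₁ facts₁)
  w∈I false = lookup⇒[]= (f w₂) I (proj₁ facts₂)

  w-untouched : ∀ b → Untouched (induce G f) H′ (w b)
  w-untouched true  = proj₂ facts₁
  w-untouched false = proj₂ facts₂

  open ModuleReinsertion G M I f module′ I⊆M image H′ w w∈I w-untouched

  w-nonadjacent : ¬ E H′ w₁ w₂
  w-nonadjacent e = independent (f w₁) (f w₂) (w∈I true) (w∈I false) (trans (sym (w-untouched true w₂)) e)

lemma20 :
    (∀ {n} (G : Graph (suc n)) (k : ℕ) (Q : Subset (suc n)) (v : Fin (suc n)) →
      IsTrueTwinClass G Q → 2 * k + 5 < ∣ Q ∣ → v ∈ Q →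
      (TPDeletion G k ⇔ TPDeletion (delVertex G v) k)
      × (TPCompletion G k ⇔ TPCompletion (delVertex G v) k))
    ×
    (∀ {n m} (G : Graph n) (k : ℕ) (M I : Subset n) (f : Fin m → Fin n) →
      IsModule G M → TriviallyPerfectOn G M →
      (∃[ J ] (J ⊆ M × IsIndependent G J × 2 * k + 5 ≤ ∣ J ∣)) →
      I ⊆ M → IsIndependent G I → ∣ I ∣ ≡ 2 * k + 4 →
      Enumerates f (λ x → x ∉ M ⊎ x ∈ I) →
      (TPDeletion G k ⇔ TPDeletion (induce G f) k)
      × (TPCompletion G k ⇔ TPCompletion (induce G f) k))
lemma20 =
  (λ G k Q v twinClass big v∈Q →
    liftable⇒safe (λ {i} {j} → punchIn-injective v i j)
      (trueTwins-liftable G k Q v (proj₁ twinClass) (≤-<-trans (+-monoʳ-≤ (2 * k) (s≤s z≤n)) big) v∈Q)) ,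
  -- The hypothesis that M has an independent set of size 2k + 5 only guarantees that I exists.
  (λ G k M I f module′ tpM _ I⊆M independent ∣I∣≡2k+4 enum →
    liftable⇒safe (proj₁ enum) (independentModule-liftable G k M I f module′ tpM I⊆M independent
      (subst (2 * k + 2 ≤_) (sym ∣I∣≡2k+4) (+-monoʳ-≤ (2 * k) (s≤s (s≤s z≤n)))) enum))
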